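{- Let $k\le l$ be positive integers with $\gcd(k,l)=1$, let $n\ge 1$ and $m\ge 0$ be integers, and write $m=qn+r$ with integers $q\ge0$, $0\le r<n$. Let $x,y$ be integers with $x\ge rk$, $y\ge rl$, $qxy+r(xl+yk)\ge klnr$, such that $x+y$ is the smallest possible among all such pairs. If $x+y\le nk$, then there exists $A\in\mathcal D^{k,l}(m,n)$ such that ${\rm tdet}(A)\le nkq+x+y$.
   Context: $\mathcal D^{k,l}(m,n)$ denotes the set of all $nk\times nl$ matrices with nonnegative integer entries all of whose row sums equal $ml$ and all of whose column sums equal $mk$. For an $s\times t$ matrix $A$ with $s\le t$, a transversal is a set of $s$ entries of $A$, one from each row, no two in the same column; if $s>t$, the transversals of $A$ are those of its transpose. For a transversal $T$, $|T|$ is the sum of its entries. The tropical determinant is ${\rm tdet}(A)=\max_T |T|$ over all transversals $T$ of $A$. -}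

module Defs where

open import Data.Nat using (ℕ; zero; suc; _+_; _*_; _≤_; _<_)
open import Data.Fin using (Fin; zero; suc)
open import Data.Product using (Σ; _×_; _,_)
open import Function.Definitions using (Injective)
open import Relation.Binary.PropositionalEquality using (_≡_)

Matrix : ℕ → ℕ → Set
Matrix s t = Fin s → Fin t → ℕ

sumFin : (n : ℕ) → (Fin n → ℕ) → ℕ
sumFin zero    f = 0
sumFin (suc n) f = f zero + sumFin n (λ i → f (suc i))

rowSum : ∀ {s t} → Matrix s t → Fin s → ℕ
rowSum {s} {t} A i = sumFin t (λ j → A i j)

colSum : ∀ {s t} → Matrix s t → Fin t → ℕ
colSum {s} {t} A j = sumFin s (λ i → A i j)

InD : (k l m n : ℕ) → Matrix (n * k) (n * l) → Set
InD k l m n A = (∀ i → rowSum A i ≡ m * l) × (∀ j → colSum A j ≡ m * k)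

-- Transversals of an s × t matrix: if s ≤ t, an injection rows → columns
-- (one entry per row, distinct columns); if s > t, transversals of the
-- transpose, i.e. an injection columns → rows.
data Transversal (s t : ℕ) : Set where
  wide : s ≤ t → (σ : Fin s → Fin t) → Injective _≡_ _≡_ σ → Transversal s t
  tall : t < s → (τ : Fin t → Fin s) → Injective _≡_ _≡_ τ → Transversal s t

weight : ∀ {s t} → Matrix s t → Transversal s t → ℕ
weight {s} {t} A (wide _ σ _) = sumFin s (λ i → A i (σ i))
weight {s} {t} A (tall _ τ _) = sumFin t (λ j → A (τ j) j)

IsTdet : ∀ {s t} → Matrix s t → ℕ → Set
IsTdet {s} {t} A d =
  Σ (Transversal s t) (λ T → weight A T ≡ d) × (∀ (T : Transversal s t) → weight A T ≤ d)

module Submission where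

-- Write N = nk, M = nl and m = qn + r, so rows must sum to R = ml and
-- columns to C = mk.  Upper bounds on the tropical determinant come from a
-- potential: if A i j ≤ U i + V j for all i, j, every transversal weighs at
-- most ΣU + ΣV (dominated-weight).  The maximum over transversals exists,
-- computed by expansion along the first row (tdet), so it suffices to build
-- a matrix in D^{k,l}(m,n) dominated by U = q + [i < x], V = [j < y], whose
-- sums are nkq + x and y.  For r = 0 the constant matrix q works.  For
-- r ≥ 1 split N = x + x̄, M = y + ȳ (module Blocks): the bottom right block
-- is constant q; the left N × y block and the top right x × ȳ block are
-- "dealt" matrices (module Dealing: items dealt round-robin into W columns
-- give prescribed row sums, equal column sums and entries ≤ ⌈row sum / W⌉),
-- with row sums a_i | b on the left and R − a_i on the right, where the a_i
-- split S = qxy + r(xl + yk) − klnr evenly among the top x rows.  The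
-- hypotheses rk ≤ x, rl ≤ y, klnr ≤ qxy + r(xl + yk) and x + y ≤ nk make all
-- sums and entry bounds work.

open import Defs
open import Data.Nat using (ℕ; zero; suc; _+_; _*_; _∸_; _≤_; _<_; z≤n; s≤s; z<s;
  _<?_; _≤?_; NonZero; >-nonZero)
open import Data.Nat.Properties
open import Data.Nat.DivMod using (_%_; m%n<n; m<n⇒m%n≡m; [m+n]%n≡m%n)
open import Data.Nat.GCD using (gcd)
open import Data.Nat.Tactic.RingSolver using (solve; solve-∀)
open import Data.Fin using (Fin; zero; suc; toℕ; punchIn; punchOut)
open import Data.Fin.Properties using (toℕ<n; punchIn-injective; punchOut-injective;
  punchIn-punchOut; punchInᵢ≢i) renaming (suc-injective to Fin-suc-injective)
open import Data.Bool using (if_then_else_)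
open import Data.List using (_∷_; [])
open import Data.Product using (Σ; _×_; _,_)
open import Data.Empty using (⊥-elim)
open import Function.Definitions using (Injective)
open import Relation.Nullary using (does; yes; no)
open import Relation.Nullary.Decidable using (dec-true; dec-false)
open import Relation.Binary.PropositionalEquality
open import Algebra.Properties.CommutativeSemigroup +-commutativeSemigroup using (interchange; x∙yz≈y∙xz)

sumFin-cong : ∀ {s} {f g : Fin s → ℕ} → (∀ i → f i ≡ g i) → sumFin s f ≡ sumFin s g
sumFin-cong {zero}  eq = refl
sumFin-cong {suc s} eq = cong₂ _+_ (eq zero) (sumFin-cong (λ i → eq (suc i)))

sumFin-mono : ∀ {s} {f g : Fin s → ℕ} → (∀ i → f i ≤ g i) → sumFin s f ≤ sumFin s g
sumFin-mono {zero}  le = z≤n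
sumFin-mono {suc s} le = +-mono-≤ (le zero) (sumFin-mono (λ i → le (suc i)))

sumFin-+ : ∀ {s} (f g : Fin s → ℕ) → sumFin s (λ i → f i + g i) ≡ sumFin s f + sumFin s g
sumFin-+ {zero}  f g = refl
sumFin-+ {suc s} f g =
  trans (cong (f zero + g zero +_) (sumFin-+ (λ i → f (suc i)) (λ i → g (suc i))))
        (interchange (f zero) (g zero) _ _)

sumFin-pivot : ∀ {t} (p : Fin (suc t)) (g : Fin (suc t) → ℕ) →
  sumFin (suc t) g ≡ g p + sumFin t (λ j → g (punchIn p j))
sumFin-pivot zero g = refl
sumFin-pivot {suc t} (suc p) g = begin
  g zero + sumFin (suc t) (λ j → g (suc j))             ≡⟨ cong (g zero +_) (sumFin-pivot p (λ j → g (suc j))) ⟩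
  g zero + (g (suc p) + rest)                           ≡⟨ x∙yz≈y∙xz (g zero) (g (suc p)) rest ⟩
  g (suc p) + (g zero + rest)                           ∎
  where
  open ≡-Reasoning
  rest = sumFin t (λ j → g (suc (punchIn p j)))

module _ {s t} (σ : Fin (suc s) → Fin (suc t)) (σ-inj : Injective _≡_ _≡_ σ) where

  σ-avoids : ∀ i → σ zero ≢ σ (suc i)
  σ-avoids i eq with σ-inj eq
  ... | ()

  restInj : Fin s → Fin t
  restInj i = punchOut (σ-avoids i)

  restInj-injective : Injective _≡_ _≡_ restInj
  restInj-injective {i} {j} eq =
    Fin-suc-injective (σ-inj (punchOut-injective (σ-avoids i) (σ-avoids j) eq))

  punchIn-restInj : ∀ i → punchIn (σ zero) (restInj i) ≡ σ (suc i)
  punchIn-restInj i = punchIn-punchOut (σ-avoids i)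

consInj : ∀ {s t} → Fin (suc t) → (Fin s → Fin t) → Fin (suc s) → Fin (suc t)
consInj p τ zero    = p
consInj p τ (suc i) = punchIn p (τ i)

consInj-injective : ∀ {s t} (p : Fin (suc t)) {τ : Fin s → Fin t} →
  Injective _≡_ _≡_ τ → Injective _≡_ _≡_ (consInj p τ)
consInj-injective p τ-inj {zero}  {zero}  _  = refl
consInj-injective p τ-inj {zero}  {suc j} eq = ⊥-elim (punchInᵢ≢i p _ (sym eq))
consInj-injective p τ-inj {suc i} {zero}  eq = ⊥-elim (punchInᵢ≢i p _ eq)
consInj-injective p τ-inj {suc i} {suc j} eq = cong suc (τ-inj (punchIn-injective p _ _ eq))

sumFin-inj : ∀ {s t} (σ : Fin s → Fin t) → Injective _≡_ _≡_ σ → (g : Fin t → ℕ) →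
  sumFin s (λ i → g (σ i)) ≤ sumFin t g
sumFin-inj {zero}          σ σ-inj g = z≤n
sumFin-inj {suc s} {zero}  σ σ-inj g with σ zero
... | ()
sumFin-inj {suc s} {suc t} σ σ-inj g = begin
  g p + sumFin s (λ i → g (σ (suc i)))
    ≡⟨ cong (g p +_) (sumFin-cong (λ i → cong g (punchIn-restInj σ σ-inj i))) ⟨
  g p + sumFin s (λ i → g (punchIn p (restInj σ σ-inj i)))
    ≤⟨ +-monoʳ-≤ (g p) (sumFin-inj (restInj σ σ-inj) (restInj-injective σ σ-inj) (λ j → g (punchIn p j))) ⟩
  g p + sumFin t (λ j → g (punchIn p j))
    ≡⟨ sumFin-pivot p g ⟨
  sumFin (suc t) g ∎
  where
  open ≤-Reasoning
  p = σ zero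

argmax : ∀ {t} → (Fin (suc t) → ℕ) → Fin (suc t)
argmax {zero}  f = zero
argmax {suc t} f with f (suc (argmax (λ j → f (suc j)))) ≤? f zero
... | yes _ = zero
... | no  _ = suc (argmax (λ j → f (suc j)))

argmax-max : ∀ {t} (f : Fin (suc t) → ℕ) j → f j ≤ f (argmax f)
argmax-max {zero}  f zero = ≤-refl
argmax-max {suc t} f j with f (suc (argmax (λ j → f (suc j)))) ≤? f zero
argmax-max {suc t} f zero    | yes _  = ≤-refl
argmax-max {suc t} f (suc j) | yes le = ≤-trans (argmax-max (λ j → f (suc j)) j) le
argmax-max {suc t} f zero    | no  gt = <⇒≤ (≰⇒> gt)
argmax-max {suc t} f (suc j) | no  _  = argmax-max (λ j → f (suc j)) j

minor : ∀ {s t} → Matrix (suc s) (suc t) → Fin (suc t) → Matrix s t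
minor A p i j = A (suc i) (punchIn p j)

mutual
  tdet : ∀ {s t} → Matrix s t → ℕ
  tdet {zero}  {t}     A = 0
  tdet {suc s} {zero}  A = 0
  tdet {suc s} {suc t} A = expansion A (argmax (expansion A))

  expansion : ∀ {s t} → Matrix (suc s) (suc t) → Fin (suc t) → ℕ
  expansion A p = A zero p + tdet (minor A p)

tdet-upper : ∀ {s t} (A : Matrix s t) (σ : Fin s → Fin t) → Injective _≡_ _≡_ σ →
  sumFin s (λ i → A i (σ i)) ≤ tdet A
tdet-upper {zero}          A σ σ-inj = z≤n
tdet-upper {suc s} {zero}  A σ σ-inj with σ zero
... | ()
tdet-upper {suc s} {suc t} A σ σ-inj = begin
  A zero p + sumFin s (λ i → A (suc i) (σ (suc i)))
    ≡⟨ cong (A zero p +_) (sumFin-cong (λ i → cong (A (suc i)) (punchIn-restInj σ σ-inj i))) ⟨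
  A zero p + sumFin s (λ i → minor A p i (restInj σ σ-inj i))
    ≤⟨ +-monoʳ-≤ (A zero p) (tdet-upper (minor A p) (restInj σ σ-inj) (restInj-injective σ σ-inj)) ⟩
  expansion A p
    ≤⟨ argmax-max (expansion A) p ⟩
  tdet A ∎
  where
  open ≤-Reasoning
  p = σ zero

tdet-attained : ∀ {s t} → s ≤ t → (A : Matrix s t) →
  Σ (Fin s → Fin t) (λ σ → Injective _≡_ _≡_ σ × sumFin s (λ i → A i (σ i)) ≡ tdet A)
tdet-attained {zero}          _         A = (λ ()) , (λ {}) , refl
tdet-attained {suc s} {suc t} (s≤s s≤t) A =
  let τ , τ-inj , τ-weight = tdet-attained s≤t (minor A p)
  in consInj p τ , consInj-injective p τ-inj , cong (A zero p +_) τ-weight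
  where p = argmax (expansion A)

isTdet-tdet : ∀ {s t} → s ≤ t → (A : Matrix s t) → IsTdet A (tdet A)
isTdet-tdet s≤t A with tdet-attained s≤t A
... | σ , σ-inj , σ-weight = (wide s≤t σ σ-inj , σ-weight) , bounded
  where
  bounded : ∀ T → weight A T ≤ tdet A
  bounded (wide _ τ τ-inj) = tdet-upper A τ τ-inj
  bounded (tall t<s _ _)   = ⊥-elim (<⇒≱ t<s s≤t)

dominated-weight : ∀ {s t} (A : Matrix s t) (u : Fin s → ℕ) (v : Fin t → ℕ) →
  (∀ i j → A i j ≤ u i + v j) → (σ : Fin s → Fin t) → Injective _≡_ _≡_ σ →
  sumFin s (λ i → A i (σ i)) ≤ sumFin s u + sumFin t v
dominated-weight {s} {t} A u v A≤u+v σ σ-inj = begin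
  sumFin s (λ i → A i (σ i))         ≤⟨ sumFin-mono (λ i → A≤u+v i (σ i)) ⟩
  sumFin s (λ i → u i + v (σ i))     ≡⟨ sumFin-+ u (λ i → v (σ i)) ⟩
  sumFin s u + sumFin s (λ i → v (σ i)) ≤⟨ +-monoʳ-≤ (sumFin s u) (sumFin-inj σ σ-inj v) ⟩
  sumFin s u + sumFin t v            ∎
  where open ≤-Reasoning

tdet-dominated : ∀ {s t} → s ≤ t → (A : Matrix s t) (u : Fin s → ℕ) (v : Fin t → ℕ) →
  (∀ i j → A i j ≤ u i + v j) → tdet A ≤ sumFin s u + sumFin t v
tdet-dominated s≤t A u v A≤u+v with tdet-attained s≤t A
... | σ , σ-inj , σ-weight = ≤-trans (≤-reflexive (sym σ-weight)) (dominated-weight A u v A≤u+v σ σ-inj)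

-- Finite sums Σ_{i<n} g i of ℕ-indexed families.  The matrix is built on
-- ℕ × ℕ and only restricted to Fin-indices at the very end.
sumN : ℕ → (ℕ → ℕ) → ℕ
sumN zero    g = 0
sumN (suc n) g = g 0 + sumN n (λ i → g (suc i))

sumFin-toℕ : ∀ n (g : ℕ → ℕ) → sumFin n (λ i → g (toℕ i)) ≡ sumN n g
sumFin-toℕ zero    g = refl
sumFin-toℕ (suc n) g = cong (g 0 +_) (sumFin-toℕ n (λ i → g (suc i)))

sumN-cong : ∀ n {f g : ℕ → ℕ} → (∀ i → i < n → f i ≡ g i) → sumN n f ≡ sumN n g
sumN-cong zero    eq = refl
sumN-cong (suc n) eq = cong₂ _+_ (eq 0 z<s) (sumN-cong n (λ i i<n → eq (suc i) (s≤s i<n)))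

sumN-+ : ∀ n (f g : ℕ → ℕ) → sumN n (λ i → f i + g i) ≡ sumN n f + sumN n g
sumN-+ zero    f g = refl
sumN-+ (suc n) f g =
  trans (cong (f 0 + g 0 +_) (sumN-+ n (λ i → f (suc i)) (λ i → g (suc i))))
        (interchange (f 0) (g 0) _ _)

sumN-split : ∀ a b (g : ℕ → ℕ) → sumN (a + b) g ≡ sumN a g + sumN b (λ i → g (a + i))
sumN-split zero    b g = refl
sumN-split (suc a) b g =
  trans (cong (g 0 +_) (sumN-split a b (λ i → g (suc i)))) (sym (+-assoc (g 0) _ _))

sumN-const : ∀ n c → sumN n (λ _ → c) ≡ n * c
sumN-const zero    c = refl
sumN-const (suc n) c = cong (c +_) (sumN-const n c)

δ : ℕ → ℕ → ℕ
δ zero    zero    = 1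
δ zero    (suc _) = 0
δ (suc _) zero    = 0
δ (suc a) (suc b) = δ a b

δ-sym : ∀ a b → δ a b ≡ δ b a
δ-sym zero    zero    = refl
δ-sym zero    (suc b) = refl
δ-sym (suc a) zero    = refl
δ-sym (suc a) (suc b) = δ-sym a b

sumN-δ : ∀ w c → c < w → sumN w (λ j → δ j c) ≡ 1
sumN-δ (suc w) zero    _         = cong suc (trans (sumN-const w 0) (*-zeroʳ w))
sumN-δ (suc w) (suc c) (s≤s c<w) = sumN-δ w c c<w

-- Gluing two families at position x: f on [0, x), then g shifted to x.
-- Kept opaque: it is only ever used through glue-< and glue-≥.
opaque
  glue : ℕ → (ℕ → ℕ) → (ℕ → ℕ) → ℕ → ℕ
  glue x f g i = if does (i <? x) then f i else g (i ∸ x)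

  glue-< : ∀ {x i} (f g : ℕ → ℕ) → i < x → glue x f g i ≡ f i
  glue-< {x} {i} f g i<x = cong (λ b → if b then f i else g (i ∸ x)) (dec-true (i <? x) i<x)

  glue-≥ : ∀ {x i} (f g : ℕ → ℕ) → x ≤ i → glue x f g i ≡ g (i ∸ x)
  glue-≥ {x} {i} f g x≤i =
    cong (λ b → if b then f i else g (i ∸ x)) (dec-false (i <? x) (≤⇒≯ x≤i))

glue-+ : ∀ x i (f g : ℕ → ℕ) → glue x f g (x + i) ≡ g i
glue-+ x i f g = trans (glue-≥ f g (m≤m+n x i)) (cong g (m+n∸m≡n x i))

sumN-glue : ∀ x x̄ (f g : ℕ → ℕ) → sumN (x + x̄) (glue x f g) ≡ sumN x f + sumN x̄ g
sumN-glue x x̄ f g = trans (sumN-split x x̄ (glue x f g))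
  (cong₂ _+_ (sumN-cong x (λ i i<x → glue-< f g i<x)) (sumN-cong x̄ (λ i _ → glue-+ x i f g)))

-- Dealing items 0, 1, 2, … round-robin into W columns: item s goes to
-- column s % W.  A row that takes a block of consecutive items gets ⌊·⌋ or
-- ⌈·⌉ of its size per column, and every W consecutive items put exactly one
-- item into each column.
module Dealing (W : ℕ) .{{_ : NonZero W}} where

  hit : ℕ → ℕ → ℕ
  hit s j = δ (s % W) j

  dealt : ℕ → ℕ → ℕ → ℕ
  dealt j a zero      = 0
  dealt j a (suc len) = hit a j + dealt j (suc a) len

  dealt-+ : ∀ j a len len′ → dealt j a (len + len′) ≡ dealt j a len + dealt j (a + len) len′
  dealt-+ j a zero      len′ = cong (λ b → dealt j b len′) (sym (+-identityʳ a))
  dealt-+ j a (suc len) len′ = begin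
    hit a j + dealt j (suc a) (len + len′)
      ≡⟨ cong (hit a j +_) (dealt-+ j (suc a) len len′) ⟩
    hit a j + (dealt j (suc a) len + dealt j (suc a + len) len′)
      ≡⟨ +-assoc (hit a j) _ _ ⟨
    dealt j a (suc len) + dealt j (suc a + len) len′
      ≡⟨ cong (λ b → dealt j a (suc len) + dealt j b len′) (+-suc a len) ⟨
    dealt j a (suc len) + dealt j (a + suc len) len′ ∎
    where open ≡-Reasoning

  dealt-mono : ∀ j a {len len′} → len ≤ len′ → dealt j a len ≤ dealt j a len′
  dealt-mono j a {len} {len′} len≤len′ = begin
    dealt j a len                                      ≤⟨ m≤m+n _ _ ⟩
    dealt j a len + dealt j (a + len) (len′ ∸ len)     ≡⟨ dealt-+ j a len (len′ ∸ len) ⟨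
    dealt j a (len + (len′ ∸ len))                     ≡⟨ cong (dealt j a) (m+[n∸m]≡n len≤len′) ⟩
    dealt j a len′                                     ∎
    where open ≤-Reasoning

  dealt-total : ∀ a len → sumN W (λ j → dealt j a len) ≡ len
  dealt-total a zero      = trans (sumN-const W 0) (*-zeroʳ W)
  dealt-total a (suc len) = begin
    sumN W (λ j → hit a j + dealt j (suc a) len)                ≡⟨ sumN-+ W (hit a) _ ⟩
    sumN W (λ j → δ (a % W) j) + sumN W (λ j → dealt j (suc a) len)
      ≡⟨ cong₂ _+_ hit-once (dealt-total (suc a) len) ⟩
    suc len                                                     ∎
    where
    open ≡-Reasoning
    hit-once : sumN W (λ j → δ (a % W) j) ≡ 1
    hit-once = trans (sumN-cong W (λ j _ → δ-sym (a % W) j)) (sumN-δ W (a % W) (m%n<n a W))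

  dealt-as-sum : ∀ j a len → dealt j a len ≡ sumN len (λ s → hit (a + s) j)
  dealt-as-sum j a zero      = refl
  dealt-as-sum j a (suc len) = cong₂ _+_
    (cong (λ b → hit b j) (sym (+-identityʳ a)))
    (trans (dealt-as-sum j (suc a) len) (sumN-cong len (λ s _ → cong (λ b → hit b j) (sym (+-suc a s)))))

  dealt-window : ∀ {j} → j < W → ∀ a → dealt j a W ≡ 1
  dealt-window {j} j<W zero = begin
    dealt j 0 W                 ≡⟨ dealt-as-sum j 0 W ⟩
    sumN W (λ s → δ (s % W) j)  ≡⟨ sumN-cong W (λ s s<W → cong (λ b → δ b j) (m<n⇒m%n≡m s<W)) ⟩
    sumN W (λ s → δ s j)        ≡⟨ sumN-δ W j j<W ⟩
    1                           ∎
    where open ≡-Reasoning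
  dealt-window {j} j<W (suc a) = trans (+-cancelˡ-≡ (hit a j) _ _ shift) (dealt-window j<W a)
    where
    open ≡-Reasoning
    shift : hit a j + dealt j (suc a) W ≡ hit a j + dealt j a W
    shift = begin
      dealt j a (suc W)                    ≡⟨ cong (dealt j a) (+-comm 1 W) ⟩
      dealt j a (W + 1)                    ≡⟨ dealt-+ j a W 1 ⟩
      dealt j a W + (hit (a + W) j + 0)    ≡⟨ cong (λ b → dealt j a W + (δ b j + 0)) ([m+n]%n≡m%n a W) ⟩
      dealt j a W + (hit a j + 0)          ≡⟨ cong (dealt j a W +_) (+-identityʳ (hit a j)) ⟩
      dealt j a W + hit a j                ≡⟨ +-comm (dealt j a W) (hit a j) ⟩
      hit a j + dealt j a W                ∎

  dealt-periods : ∀ {j} → j < W → ∀ a u → dealt j a (u * W) ≡ u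
  dealt-periods j<W a zero    = refl
  dealt-periods {j} j<W a (suc u) =
    trans (dealt-+ j a W (u * W)) (cong₂ _+_ (dealt-window j<W a) (dealt-periods j<W (a + W) u))

  dealt-≤ : ∀ {j} → j < W → ∀ a {len} u → len ≤ u * W → dealt j a len ≤ u
  dealt-≤ {j} j<W a u len≤uW =
    ≤-trans (dealt-mono j a len≤uW) (≤-reflexive (dealt-periods j<W a u))

  dealt-≥ : ∀ {j} → j < W → ∀ a {len} u v → u * W ≤ len + v * W → u ≤ dealt j a len + v
  dealt-≥ {j} j<W a {len} u v uW≤len+vW = begin
    u                                       ≡⟨ dealt-periods j<W a u ⟨
    dealt j a (u * W)                       ≤⟨ dealt-mono j a uW≤len+vW ⟩
    dealt j a (len + v * W)                 ≡⟨ dealt-+ j a len (v * W) ⟩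
    dealt j a len + dealt j (a + len) (v * W) ≡⟨ cong (dealt j a len +_) (dealt-periods j<W (a + len) v) ⟩
    dealt j a len + v                       ∎
    where open ≤-Reasoning

  dealt-blocks : ∀ j h (ρ : ℕ → ℕ) a →
    sumN h (λ i → dealt j (a + sumN i ρ) (ρ i)) ≡ dealt j a (sumN h ρ)
  dealt-blocks j zero    ρ a = refl
  dealt-blocks j (suc h) ρ a = begin
    dealt j (a + 0) (ρ 0) + sumN h (λ i → dealt j (a + (ρ 0 + sumN i ρ′)) (ρ′ i))
      ≡⟨ cong₂ _+_ (cong (λ b → dealt j b (ρ 0)) (+-identityʳ a))
                   (sumN-cong h (λ i _ → cong (λ b → dealt j b (ρ′ i)) (sym (+-assoc a (ρ 0) _)))) ⟩
    dealt j a (ρ 0) + sumN h (λ i → dealt j (a + ρ 0 + sumN i ρ′) (ρ′ i))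
      ≡⟨ cong (dealt j a (ρ 0) +_) (dealt-blocks j h ρ′ (a + ρ 0)) ⟩
    dealt j a (ρ 0) + dealt j (a + ρ 0) (sumN h ρ′)
      ≡⟨ dealt-+ j a (ρ 0) (sumN h ρ′) ⟨
    dealt j a (ρ 0 + sumN h ρ′) ∎
    where
    open ≡-Reasoning
    ρ′ = λ i → ρ (suc i)

  deal : (ℕ → ℕ) → ℕ → ℕ → ℕ
  deal ρ i j = dealt j (sumN i ρ) (ρ i)

  deal-row : ∀ ρ i → sumN W (deal ρ i) ≡ ρ i
  deal-row ρ i = dealt-total (sumN i ρ) (ρ i)

  deal-col : ∀ ρ h c → sumN h ρ ≡ c * W → ∀ {j} → j < W → sumN h (λ i → deal ρ i j) ≡ c
  deal-col ρ h c total j<W =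
    trans (dealt-blocks _ h ρ 0) (trans (cong (dealt _ 0) total) (dealt-periods j<W 0 c))

  deal-entry : ∀ ρ i u → ρ i ≤ u * W → ∀ {j} → j < W → deal ρ i j ≤ u
  deal-entry ρ i u ρi≤uW j<W = dealt-≤ j<W (sumN i ρ) u ρi≤uW

Witness : (k l m n β : ℕ) → Set
Witness k l m n β =
  Σ (Matrix (n * k) (n * l)) (λ A → InD k l m n A × Σ ℕ (λ d → IsTdet A d × d ≤ β))

witness-weaken : ∀ {k l m n β β′} → β ≤ β′ → Witness k l m n β → Witness k l m n β′
witness-weaken β≤β′ (A , A∈D , d , d-tdet , d≤β) = A , A∈D , d , d-tdet , ≤-trans d≤β β≤β′

witness-from-array : ∀ k l m n → k ≤ l → (F : ℕ → ℕ → ℕ) (u v : ℕ → ℕ) →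
  (∀ i → i < n * k → sumN (n * l) (F i) ≡ m * l) →
  (∀ j → j < n * l → sumN (n * k) (λ i → F i j) ≡ m * k) →
  (∀ i j → j < n * l → F i j ≤ u i + v j) →
  Witness k l m n (sumN (n * k) u + sumN (n * l) v)
witness-from-array k l m n k≤l F u v rows cols F≤u+v =
  A , (row-sums , col-sums) , tdet A , isTdet-tdet nk≤nl A , tdet-bound
  where
  A : Matrix (n * k) (n * l)
  A i j = F (toℕ i) (toℕ j)

  nk≤nl : n * k ≤ n * l
  nk≤nl = *-monoʳ-≤ n k≤l

  row-sums : ∀ i → rowSum A i ≡ m * l
  row-sums i = trans (sumFin-toℕ (n * l) (F (toℕ i))) (rows (toℕ i) (toℕ<n i))

  col-sums : ∀ j → colSum A j ≡ m * k
  col-sums j = trans (sumFin-toℕ (n * k) (λ i → F i (toℕ j))) (cols (toℕ j) (toℕ<n j))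

  tdet-bound : tdet A ≤ sumN (n * k) u + sumN (n * l) v
  tdet-bound = ≤-trans
    (tdet-dominated nk≤nl A (λ i → u (toℕ i)) (λ j → v (toℕ j)) (λ i j → F≤u+v _ _ (toℕ<n j)))
    (≤-reflexive (cong₂ _+_ (sumFin-toℕ (n * k) u) (sumFin-toℕ (n * l) v)))

divisible-witness : ∀ k l n q → k ≤ l → Witness k l (q * n + 0) n (n * k * q)
divisible-witness k l n q k≤l = witness-weaken {k} {l} {q * n + 0} {n} total
  (witness-from-array k l (q * n + 0) n k≤l (λ _ _ → q) (λ _ → q) (λ _ → 0)
    (λ _ _ → trans (sumN-const (n * l) q) (const-sum n l q))
    (λ _ _ → trans (sumN-const (n * k) q) (const-sum n k q))
    (λ _ _ _ → m≤m+n q 0))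
  where
  const-sum : ∀ n l q → n * l * q ≡ (q * n + 0) * l
  const-sum = solve-∀
  total : sumN (n * k) (λ _ → q) + sumN (n * l) (λ _ → 0) ≤ n * k * q
  total = ≤-reflexive (begin
    sumN (n * k) (λ _ → q) + sumN (n * l) (λ _ → 0) ≡⟨ cong₂ _+_ (sumN-const (n * k) q) (sumN-const (n * l) 0) ⟩
    n * k * q + n * l * 0                           ≡⟨ cong (n * k * q +_) (*-zeroʳ (n * l)) ⟩
    n * k * q + 0                                   ≡⟨ +-identityʳ (n * k * q) ⟩
    n * k * q                                       ∎)
    where open ≡-Reasoning

cancel-through : ∀ {c a s κ t} → s + κ ≡ t → c + κ ≡ a + t → c ≡ a + s
cancel-through {c} {a} {s} {κ} s+κ≡t c+κ≡a+t = +-cancelʳ-≡ κ c (a + s)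
  (trans c+κ≡a+t (trans (cong (a +_) (sym s+κ≡t)) (sym (+-assoc a s κ))))

module Blocks (k l n q r x x̄ y ȳ : ℕ) .{{_ : NonZero x}} .{{_ : NonZero y}} .{{_ : NonZero ȳ}}
  (rows-split : x + x̄ ≡ n * k) (cols-split : y + ȳ ≡ n * l)
  (rk≤x : r * k ≤ x) (rl≤y : r * l ≤ y)
  (K≤T : k * l * n * r ≤ q * x * y + r * (x * l + y * k)) where

  R C K T b S : ℕ
  R = (q * n + r) * l
  C = (q * n + r) * k
  K = k * l * n * r
  T = q * x * y + r * (x * l + y * k)
  -- row sum of the left part of a bottom row
  b = r * l + q * y
  -- total of the left parts of the top x rows
  S = T ∸ K

  C-split : C ≡ q * (x + x̄) + r * k
  C-split = begin
    (q * n + r) * k       ≡⟨ solve (q ∷ n ∷ r ∷ k ∷ []) ⟩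
    q * (n * k) + r * k   ≡⟨ cong (λ N → q * N + r * k) rows-split ⟨
    q * (x + x̄) + r * k   ∎
    where open ≡-Reasoning

  R-split : R ≡ q * (y + ȳ) + r * l
  R-split = begin
    (q * n + r) * l       ≡⟨ solve (q ∷ n ∷ r ∷ l ∷ []) ⟩
    q * (n * l) + r * l   ≡⟨ cong (λ M → q * M + r * l) cols-split ⟨
    q * (y + ȳ) + r * l   ∎
    where open ≡-Reasoning

  K-by-rows : K ≡ r * l * (x + x̄)
  K-by-rows = begin
    k * l * n * r         ≡⟨ solve (k ∷ l ∷ n ∷ r ∷ []) ⟩
    r * l * (n * k)       ≡⟨ cong (r * l *_) rows-split ⟨
    r * l * (x + x̄)       ∎
    where open ≡-Reasoning

  K-by-cols : K ≡ r * k * (y + ȳ)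
  K-by-cols = begin
    k * l * n * r         ≡⟨ solve (k ∷ l ∷ n ∷ r ∷ []) ⟩
    r * k * (n * l)       ≡⟨ cong (r * k *_) cols-split ⟨
    r * k * (y + ȳ)       ∎
    where open ≡-Reasoning

  S+K : S + K ≡ T
  S+K = m∸n+n≡m K≤T

  -- the y left columns must carry C each: the top rows contribute S, the
  -- bottom rows x̄ · b
  left-total : C * y ≡ x̄ * b + S
  left-total = cancel-through S+K (begin
    C * y + K                                     ≡⟨ cong₂ (λ c κ → c * y + κ) C-split K-by-rows ⟩
    (q * (x + x̄) + r * k) * y + r * l * (x + x̄)   ≡⟨ solve (q ∷ x ∷ x̄ ∷ r ∷ k ∷ l ∷ y ∷ []) ⟩
    x̄ * (r * l + q * y) + (q * x * y + r * (x * l + y * k)) ∎)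
    where open ≡-Reasoning

  -- the top x rows carry R each: S on the left, the rest on the right
  right-total : R * x ≡ (r * k + q * x) * ȳ + S
  right-total = cancel-through S+K (begin
    R * x + K                                     ≡⟨ cong₂ (λ ρ κ → ρ * x + κ) R-split K-by-cols ⟩
    (q * (y + ȳ) + r * l) * x + r * k * (y + ȳ)   ≡⟨ solve (q ∷ y ∷ ȳ ∷ r ∷ l ∷ x ∷ k ∷ []) ⟩
    (r * k + q * x) * ȳ + (q * x * y + r * (x * l + y * k)) ∎)
    where open ≡-Reasoning

  -- a bottom row: b on the left, q in each of the ȳ right columns
  bottom-row : b + ȳ * q ≡ R
  bottom-row = begin
    r * l + q * y + ȳ * q   ≡⟨ solve (r ∷ l ∷ q ∷ y ∷ ȳ ∷ []) ⟩
    q * (y + ȳ) + r * l     ≡⟨ R-split ⟨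
    R                       ∎
    where open ≡-Reasoning

  -- a right column: r k + q x from the top rows, q from each bottom row
  right-col : r * k + q * x + x̄ * q ≡ C
  right-col = begin
    r * k + q * x + x̄ * q   ≡⟨ solve (r ∷ k ∷ q ∷ x ∷ x̄ ∷ []) ⟩
    q * (x + x̄) + r * k     ≡⟨ C-split ⟨
    C                       ∎
    where open ≡-Reasoning

  -- Size bounds that keep every entry below the potential: b ≤ (q+1) y,
  -- and S/x lies between R − (q+1) ȳ and min(R, (q+2) y).
  b≤ : b ≤ suc q * y
  b≤ = +-monoˡ-≤ (q * y) rl≤y

  S≤ : S ≤ suc (suc q) * y * x
  S≤ = begin
    S                                     ≤⟨ m∸n≤m T K ⟩
    q * x * y + r * (x * l + y * k)       ≡⟨ solve (q ∷ x ∷ y ∷ r ∷ l ∷ k ∷ []) ⟩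
    q * y * x + (r * l * x + r * k * y)   ≤⟨ +-monoʳ-≤ (q * y * x) (+-mono-≤ (*-monoˡ-≤ x rl≤y) (*-monoˡ-≤ y rk≤x)) ⟩
    q * y * x + (y * x + x * y)           ≡⟨ solve (q ∷ y ∷ x ∷ []) ⟩
    suc (suc q) * y * x                   ∎
    where open ≤-Reasoning

  S≤Rx : S ≤ R * x
  S≤Rx = ≤-trans (m≤n+m S _) (≤-reflexive (sym right-total))

  Rx≤ : R * x ≤ S + suc q * ȳ * x
  Rx≤ = begin
    R * x                         ≡⟨ right-total ⟩
    (r * k + q * x) * ȳ + S       ≤⟨ +-monoˡ-≤ S (*-monoˡ-≤ ȳ (+-monoˡ-≤ (q * x) rk≤x)) ⟩
    (x + q * x) * ȳ + S           ≡⟨ solve (x ∷ q ∷ ȳ ∷ []) ⟨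
    S + suc q * ȳ * x             ∎
    where open ≤-Reasoning

  -- The top x rows split S evenly: share i is ⌊S/x⌋ or ⌈S/x⌉.
  module Rows = Dealing x

  share : ℕ → ℕ
  share i = Rows.dealt i 0 S

  share-total : sumN x share ≡ S
  share-total = Rows.dealt-total 0 S

  share≤R : ∀ {i} → i < x → share i ≤ R
  share≤R i<x = Rows.dealt-≤ i<x 0 R S≤Rx

  share≤ : ∀ {i} → i < x → share i ≤ suc (suc q) * y
  share≤ i<x = Rows.dealt-≤ i<x 0 (suc (suc q) * y) S≤

  R∸share≤ : ∀ {i} → i < x → R ∸ share i ≤ suc q * ȳ
  R∸share≤ {i} i<x = m≤n+o⇒m∸n≤o R (share i) (Rows.dealt-≥ i<x 0 R (suc q * ȳ) Rx≤)

  module Left = Dealing y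

  ρL : ℕ → ℕ
  ρL = glue x share (λ _ → b)

  ρL-total : sumN (x + x̄) ρL ≡ C * y
  ρL-total = begin
    sumN (x + x̄) ρL               ≡⟨ sumN-glue x x̄ share (λ _ → b) ⟩
    sumN x share + sumN x̄ (λ _ → b) ≡⟨ cong₂ _+_ share-total (sumN-const x̄ b) ⟩
    S + x̄ * b                      ≡⟨ +-comm S (x̄ * b) ⟩
    x̄ * b + S                      ≡⟨ left-total ⟨
    C * y                          ∎
    where open ≡-Reasoning

  left : ℕ → ℕ → ℕ
  left = Left.deal ρL

  module Right = Dealing ȳ

  ρR : ℕ → ℕ
  ρR i = R ∸ share i

  ρR-total : sumN x ρR ≡ (r * k + q * x) * ȳ
  ρR-total = +-cancelʳ-≡ S _ _ (begin
    sumN x ρR + S                         ≡⟨ cong (sumN x ρR +_) share-total ⟨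
    sumN x ρR + sumN x share              ≡⟨ sumN-+ x ρR share ⟨
    sumN x (λ i → ρR i + share i)         ≡⟨ sumN-cong x (λ i i<x → m∸n+n≡m (share≤R i<x)) ⟩
    sumN x (λ _ → R)                      ≡⟨ sumN-const x R ⟩
    x * R                                 ≡⟨ *-comm x R ⟩
    R * x                                 ≡⟨ right-total ⟩
    (r * k + q * x) * ȳ + S               ∎)
    where open ≡-Reasoning

  right : ℕ → ℕ → ℕ
  right i j′ = glue x (λ i′ → Right.deal ρR i′ j′) (λ _ → q) i

  array : ℕ → ℕ → ℕ
  array i j = glue y (left i) (right i) j

  row-sum : ∀ i → sumN (y + ȳ) (array i) ≡ R
  row-sum i = begin
    sumN (y + ȳ) (array i)                 ≡⟨ sumN-glue y ȳ (left i) (right i) ⟩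
    sumN y (left i) + sumN ȳ (right i)     ≡⟨ cong (_+ sumN ȳ (right i)) (Left.deal-row ρL i) ⟩
    ρL i + sumN ȳ (right i)                ≡⟨ completes ⟩
    R                                      ∎
    where
    open ≡-Reasoning
    completes : ρL i + sumN ȳ (right i) ≡ R
    completes with i <? x
    ... | yes i<x = begin
      ρL i + sumN ȳ (right i)            ≡⟨ cong₂ _+_ (glue-< share _ i<x)
                                              (sumN-cong ȳ (λ j′ _ → glue-< _ _ i<x)) ⟩
      share i + sumN ȳ (Right.deal ρR i) ≡⟨ cong (share i +_) (Right.deal-row ρR i) ⟩
      share i + (R ∸ share i)            ≡⟨ m+[n∸m]≡n (share≤R i<x) ⟩
      R                                  ∎
    ... | no i≮x = begin
      ρL i + sumN ȳ (right i)            ≡⟨ cong₂ _+_ (glue-≥ share _ (≮⇒≥ i≮x))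
                                              (sumN-cong ȳ (λ j′ _ → glue-≥ _ _ (≮⇒≥ i≮x))) ⟩
      b + sumN ȳ (λ _ → q)               ≡⟨ cong (b +_) (sumN-const ȳ q) ⟩
      b + ȳ * q                          ≡⟨ bottom-row ⟩
      R                                  ∎

  col-sum : ∀ j → j < y + ȳ → sumN (x + x̄) (λ i → array i j) ≡ C
  col-sum j j<y+ȳ with j <? y
  ... | yes j<y = trans (sumN-cong (x + x̄) (λ i _ → glue-< (left i) (right i) j<y))
                        (Left.deal-col ρL (x + x̄) C ρL-total j<y)
  ... | no j≮y = begin
    sumN (x + x̄) (λ i → array i j)                      ≡⟨ sumN-cong (x + x̄) (λ i _ → glue-≥ (left i) (right i) (≮⇒≥ j≮y)) ⟩
    sumN (x + x̄) (λ i → right i j′)                     ≡⟨ sumN-glue x x̄ (λ i → Right.deal ρR i j′) (λ _ → q) ⟩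
    sumN x (λ i → Right.deal ρR i j′) + sumN x̄ (λ _ → q) ≡⟨ cong₂ _+_ (Right.deal-col ρR x _ ρR-total j′<ȳ) (sumN-const x̄ q) ⟩
    r * k + q * x + x̄ * q                               ≡⟨ right-col ⟩
    C                                                   ∎
    where
    open ≡-Reasoning
    j′ = j ∸ y
    j′<ȳ : j′ < ȳ
    j′<ȳ = m<n+o⇒m∸n<o j y j<y+ȳ

  U V : ℕ → ℕ
  U = glue x (λ _ → suc q) (λ _ → q)
  V = glue y (λ _ → 1) (λ _ → 0)

  -- top left entries are ≤ ⌈share i / y⌉ ≤ q + 2
  top-left : ∀ {i j} → i < x → j < y → array i j ≤ U i + V j
  top-left {i} {j} i<x j<y = begin
    array i j      ≡⟨ glue-< (left i) (right i) j<y ⟩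
    left i j       ≤⟨ Left.deal-entry ρL i _ (≤-trans (≤-reflexive (glue-< share _ i<x)) (share≤ i<x)) j<y ⟩
    suc (suc q)    ≡⟨ +-comm (suc q) 1 ⟨
    suc q + 1      ≡⟨ cong₂ _+_ (glue-< _ _ i<x) (glue-< _ _ j<y) ⟨
    U i + V j      ∎
    where open ≤-Reasoning

  -- bottom left entries are ≤ ⌈b / y⌉ ≤ q + 1
  bottom-left : ∀ {i j} → x ≤ i → j < y → array i j ≤ U i + V j
  bottom-left {i} {j} x≤i j<y = begin
    array i j      ≡⟨ glue-< (left i) (right i) j<y ⟩
    left i j       ≤⟨ Left.deal-entry ρL i _ (≤-trans (≤-reflexive (glue-≥ share _ x≤i)) b≤) j<y ⟩
    suc q          ≡⟨ +-comm q 1 ⟨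
    q + 1          ≡⟨ cong₂ _+_ (glue-≥ _ _ x≤i) (glue-< _ _ j<y) ⟨
    U i + V j      ∎
    where open ≤-Reasoning

  -- top right entries are ≤ ⌈(R ∸ share i) / ȳ⌉ ≤ q + 1
  top-right : ∀ {i j} → i < x → y ≤ j → j < y + ȳ → array i j ≤ U i + V j
  top-right {i} {j} i<x y≤j j<y+ȳ = begin
    array i j                   ≡⟨ glue-≥ (left i) (right i) y≤j ⟩
    right i (j ∸ y)             ≡⟨ glue-< _ _ i<x ⟩
    Right.deal ρR i (j ∸ y)     ≤⟨ Right.deal-entry ρR i _ (R∸share≤ i<x) (m<n+o⇒m∸n<o j y j<y+ȳ) ⟩
    suc q                       ≡⟨ +-identityʳ (suc q) ⟨
    suc q + 0                   ≡⟨ cong₂ _+_ (glue-< _ _ i<x) (glue-≥ _ _ y≤j) ⟨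
    U i + V j                   ∎
    where open ≤-Reasoning

  bottom-right : ∀ {i j} → x ≤ i → y ≤ j → array i j ≤ U i + V j
  bottom-right {i} {j} x≤i y≤j = begin
    array i j           ≡⟨ glue-≥ (left i) (right i) y≤j ⟩
    right i (j ∸ y)     ≡⟨ glue-≥ _ _ x≤i ⟩
    q                   ≡⟨ +-identityʳ q ⟨
    q + 0               ≡⟨ cong₂ _+_ (glue-≥ _ _ x≤i) (glue-≥ _ _ y≤j) ⟨
    U i + V j           ∎
    where open ≤-Reasoning

  dominated : ∀ i j → j < y + ȳ → array i j ≤ U i + V j
  dominated i j j<y+ȳ with i <? x | j <? y
  ... | yes i<x | yes j<y = top-left i<x j<y
  ... | no  i≮x | yes j<y = bottom-left (≮⇒≥ i≮x) j<y
  ... | yes i<x | no  j≮y = top-right i<x (≮⇒≥ j≮y) j<y+ȳ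
  ... | no  i≮x | no  j≮y = bottom-right (≮⇒≥ i≮x) (≮⇒≥ j≮y)

  U-total : sumN (n * k) U ≡ n * k * q + x
  U-total = begin
    sumN (n * k) U                ≡⟨ cong (λ N → sumN N U) rows-split ⟨
    sumN (x + x̄) U                ≡⟨ sumN-glue x x̄ _ _ ⟩
    sumN x (λ _ → suc q) + sumN x̄ (λ _ → q) ≡⟨ cong₂ _+_ (sumN-const x (suc q)) (sumN-const x̄ q) ⟩
    x * suc q + x̄ * q             ≡⟨ solve (x ∷ q ∷ x̄ ∷ []) ⟩
    (x + x̄) * q + x               ≡⟨ cong (λ N → N * q + x) rows-split ⟩
    n * k * q + x                 ∎
    where open ≡-Reasoning

  V-total : sumN (n * l) V ≡ y
  V-total = begin
    sumN (n * l) V                ≡⟨ cong (λ M → sumN M V) cols-split ⟨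
    sumN (y + ȳ) V                ≡⟨ sumN-glue y ȳ _ _ ⟩
    sumN y (λ _ → 1) + sumN ȳ (λ _ → 0) ≡⟨ cong₂ _+_ (sumN-const y 1) (sumN-const ȳ 0) ⟩
    y * 1 + ȳ * 0                 ≡⟨ solve (y ∷ ȳ ∷ []) ⟩
    y                             ∎
    where open ≡-Reasoning

  witness : k ≤ l → Witness k l (q * n + r) n (n * k * q + x + y)
  witness k≤l = witness-weaken {k} {l} {q * n + r} {n} (≤-reflexive (cong₂ _+_ U-total V-total))
    (witness-from-array k l (q * n + r) n k≤l array U V
      (λ i _ → trans (cong (λ M → sumN M (array i)) (sym cols-split)) (row-sum i))
      (λ j j<nl → trans (cong (λ N → sumN N (λ i → array i j)) (sym rows-split))
                        (col-sum j (subst (j <_) (sym cols-split) j<nl)))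
      (λ i j j<nl → dominated i j (subst (j <_) (sym cols-split) j<nl)))

-- r = 0: the constant matrix; r ≥ 1: the block matrix, whose block sizes
-- x, y and ȳ = nl − y are positive because rk ≤ x, rl ≤ y and x + y ≤ nk ≤ nl.
mainTheorem4 :
    (k l n m q r x y : ℕ) →
    1 ≤ k → k ≤ l → gcd k l ≡ 1 → 1 ≤ n →
    m ≡ q * n + r → r < n →
    r * k ≤ x → r * l ≤ y → k * l * n * r ≤ q * x * y + r * (x * l + y * k) →
    (∀ (x′ y′ : ℕ) → r * k ≤ x′ → r * l ≤ y′ →
      k * l * n * r ≤ q * x′ * y′ + r * (x′ * l + y′ * k) → x + y ≤ x′ + y′) →
    x + y ≤ n * k →
    Σ (Matrix (n * k) (n * l)) (λ A → InD k l m n A ×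
      Σ ℕ (λ d → IsTdet A d × d ≤ n * k * q + x + y))
mainTheorem4 k l n _ q zero x y _ k≤l _ _ refl _ _ _ _ _ _ =
  witness-weaken {k} {l} {q * n + 0} {n} (≤-trans (m≤m+n (n * k * q) x) (m≤m+n _ y))
    (divisible-witness k l n q k≤l)
mainTheorem4 k l n _ q r@(suc _) x y 1≤k k≤l _ _ refl _ rk≤x rl≤y K≤T _ x+y≤nk =
  Blocks.witness k l n q r x (n * k ∸ x) y (n * l ∸ y)
    {{>-nonZero 0<x}} {{>-nonZero 0<y}} {{>-nonZero (m<n⇒0<n∸m y<nl)}}
    (m+[n∸m]≡n x≤nk) (m+[n∸m]≡n (<⇒≤ y<nl)) rk≤x rl≤y K≤T k≤l
  where
  0<rk : 0 < r * k
  0<rk = ≤-trans 1≤k (m≤m+n k _)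
  0<x : 0 < x
  0<x = ≤-trans 0<rk rk≤x
  0<y : 0 < y
  0<y = ≤-trans 0<rk (≤-trans (*-monoʳ-≤ r k≤l) rl≤y)
  x≤nk : x ≤ n * k
  x≤nk = ≤-trans (m≤m+n x y) x+y≤nk
  y<nl : y < n * l
  y<nl = ≤-trans (m<n+m y 0<x) (≤-trans x+y≤nk (*-monoʳ-≤ n k≤l))
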